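{- Let $\mathcal C$ and $\mathcal D$ be codes with $[\mathcal D]<[\mathcal C]$ in $\mathbf{P}_{\mathbf{Code}}$. Then $\mathcal D$ has strictly fewer trunks than $\mathcal C$.
   Context: A code is a subset $\mathcal C\subseteq 2^{[n]}$. For $\sigma\subseteq[n]$, $\mathrm{Tk}_{\mathcal C}(\sigma)=\{c\in\mathcal C\mid\sigma\subseteq c\}$. A trunk in $\mathcal C$ is a subset of $\mathcal C$ that is empty or equal to $\mathrm{Tk}_{\mathcal C}(\sigma)$ for some $\sigma\subseteq[n]$; the number of trunks is the number of distinct such subsets. A morphism between codes $\mathcal C\subseteq 2^{[n]}$, $\mathcal D\subseteq 2^{[m]}$ is a function $f:\mathcal C\to\mathcal D$ such that the preimage of every trunk in $\mathcal D$ is a trunk in $\mathcal C$; an isomorphism is a bijective morphism whose inverse is a morphism. An operation on a code $\mathcal C$ consists of replacing $\mathcal C$ by one of its trunks (regarded as a code), or by its image $f(\mathcal C)$ under some morphism $f$. For isomorphism classes of codes, $[\mathcal C]\le[\mathcal D]$ if there is a finite sequence of operations taking $\mathcal D$ to a code isomorphic to $\mathcal C$; this is a partial order, and the resulting poset is denoted $\mathbf{P}_{\mathbf{Code}}$. -}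

module Defs where

open import Data.Nat using (ℕ; zero; suc; _<_)
open import Data.Bool using (Bool; true; false; _∧_; T; if_then_else_)
open import Data.Bool.Properties using (_≟_)
open import Data.Fin.Subset using (Subset; _⊆_; inside; outside)
open import Data.Fin.Subset.Properties using (_⊆?_)
open import Data.Vec using ([]; _∷_)
open import Data.List using (List; []; _∷_; map; _++_; length; deduplicateᵇ)
open import Data.Bool.ListAction using (and)
open import Data.Product using (Σ; ∃; _×_; _,_; proj₁; proj₂)
open import Data.Sum using (_⊎_)
open import Data.Empty using (⊥)
open import Relation.Nullary using (¬_; does)
open import Relation.Binary.PropositionalEquality using (_≡_)
open import Function.Bundles using (_⇔_)

-- Codes: a code C ⊆ 2^[n] is given by its (decidable) membership
-- predicate on subsets of [n] = Fin n.

record Code : Set where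
  constructor code
  field
    dim : ℕ
    mem : Subset dim → Bool
open Code public

Elem : Code → Set
Elem C = Σ (Subset (dim C)) (λ c → T (mem C c))

-- a predicate P on the codewords of C (a subset of C) is a trunk if it
-- is empty or equal to Tk_C(σ) = { c ∈ C | σ ⊆ c } for some σ ⊆ [n]
IsTrunk : (C : Code) → (Elem C → Set) → Set
IsTrunk C P =
  (∀ x → ¬ P x) ⊎ (Σ (Subset (dim C)) λ σ → ∀ x → P x ⇔ (σ ⊆ proj₁ x))

record Morphism (C D : Code) : Set₁ where
  field
    fun       : Elem C → Elem D
    preTrunk  : ∀ (Q : Elem D → Set) → IsTrunk D Q → IsTrunk C (λ x → Q (fun x))
open Morphism public

record Iso (C D : Code) : Set₁ where
  field
    to      : Morphism C D
    from    : Morphism D C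
    from-to : ∀ x → proj₁ (fun from (fun to x)) ≡ proj₁ x
    to-from : ∀ y → proj₁ (fun to (fun from y)) ≡ proj₁ y
open Iso public

data Step (C : Code) : Code → Set₁ where
  -- replace C by its empty trunk (regarded as a code in 2^[n])
  emptyTrunk : (E : Subset (dim C) → Bool) →
               (∀ c → ¬ T (E c)) → Step C (code (dim C) E)
  -- replace C by the trunk Tk_C(σ) (regarded as a code in 2^[n])
  trunk      : (E : Subset (dim C) → Bool) (σ : Subset (dim C)) →
               (∀ c → T (E c) ⇔ (T (mem C c) × σ ⊆ c)) →
               Step C (code (dim C) E)
  -- replace C by its image f(C) ⊆ 2^[m] under a morphism f : C → D'
  image      : (D' : Code) (f : Morphism C D') (E : Subset (dim D') → Bool) →
               (∀ d → T (E d) ⇔ (Σ (Elem C) λ x → proj₁ (fun f x) ≡ d)) →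
               Step C (code (dim D') E)

data Steps (C : Code) : Code → Set₁ where
  done : Steps C C
  _then_ : ∀ {D E} → Steps C D → Step D E → Steps C E

-- [C] ≤ [D] : a finite sequence of operations takes D to a code
-- isomorphic to C
_≼_ : Code → Code → Set₁
C ≼ D = Σ Code λ E → Steps D E × Iso E C

_≺_ : Code → Code → Set₁
C ≺ D = C ≼ D × ¬ Iso C D

allSubsets : (n : ℕ) → List (Subset n)
allSubsets zero    = [] ∷ []
allSubsets (suc n) = map (outside ∷_) (allSubsets n) ++ map (inside ∷_) (allSubsets n)

tkFun : (C : Code) → Subset (dim C) → Subset (dim C) → Bool
tkFun C σ c = mem C c ∧ does (σ ⊆? c)

eqFun : {n : ℕ} → (Subset n → Bool) → (Subset n → Bool) → Bool
eqFun {n} f g = and (map (λ c → does (f c ≟ g c)) (allSubsets n))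

numTrunks : Code → ℕ
numTrunks C =
  length (deduplicateᵇ eqFun ((λ _ → false) ∷ map (tkFun C) (allSubsets (dim C))))

module Submission where

-- Every operation either loses a trunk or produces an isomorphic code, and the number of trunks
-- is an isomorphism invariant (an isomorphic copy of C is the image of C under a morphism).
--
-- A trunk E of C is a subcode whose trunks Tk_E(τ) = Tk_C(σ ∪ τ) are trunks of C, and unless
-- E = C the trunk C = Tk_C(∅) is lost.  For the image f(C) of a morphism, pulling back along f
-- maps the trunks of f(C) injectively to trunks of C.  If no trunk is lost this map is onto,
-- so the trunks Tk_C(c) are pullbacks; they separate the fibres of f, hence f is injective,
-- and its inverse pulls every trunk of C back to a trunk of f(C), so f : C → f(C) is an
-- isomorphism.

open import Defs
open import Data.Bool using (Bool; true; false; T; _∧_)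
open import Data.Bool.Properties using (_≟_; T-≡; T-∧; T-irrelevant)
open import Data.Fin using (Fin; zero; suc)
open import Data.Fin.Properties using (pigeonhole; <⇒≢)
open import Data.Fin.Subset using (Subset; _⊆_; _∪_; ⊥; inside; outside)
open import Data.Fin.Subset.Properties
  using (_⊆?_; ⊆-min; ⊆-refl; ⊆-antisym; p⊆p∪q; q⊆p∪q; x∈p∪q⁻)
open import Data.List using (List; _∷_; map; length; lookup; deduplicate)
open import Data.List.Membership.Propositional using (_∈_; find; lose)
open import Data.List.Membership.Propositional.Properties
  using (∈-map⁺; ∈-map⁻; ∈-++⁺ˡ; ∈-++⁺ʳ; ∈-lookup; ∈-deduplicate⁻)
import Data.List.Membership.Setoid as SetoidMembership
open import Data.List.Membership.Setoid.Properties using (index-injective; ∈-deduplicate⁺)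
import Data.List.Relation.Unary.All as All
open import Data.List.Relation.Unary.All.Properties using (all⁺; all⁻)
open import Data.List.Relation.Unary.AllPairs.Core using (_∷_)
open import Data.List.Relation.Unary.Any as Any using (here; there)
open import Data.List.Relation.Unary.Any.Properties using (map⁺)
import Data.List.Relation.Unary.Unique.Setoid as SetoidUnique
open import Data.List.Relation.Unary.Unique.DecSetoid.Properties using (deduplicate-!)
open import Data.Nat using (ℕ; suc; _≤_; _<_; _≤?_; _<?_)
open import Data.Nat.Properties using (≰⇒>; <-trans; <-≤-trans; ≤-<-trans)
open import Data.Product using (∃; _×_; _,_; proj₁; proj₂)
open import Data.Product.Function.NonDependent.Propositional using (_×-⇔_)
open import Data.Sum using (_⊎_; inj₁; inj₂; [_,_])
open import Data.Vec using ([]; _∷_)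
open import Function using (_∘_; id)
open import Function.Bundles using (_⇔_; mk⇔; module Equivalence)
open import Function.Construct.Composition using (_⇔-∘_)
open import Function.Construct.Identity using (⇔-id)
open import Function.Construct.Symmetry using (⇔-sym)
open import Level using (0ℓ)
open import Relation.Binary.Bundles using (Setoid; DecSetoid)
open import Relation.Binary.Properties.Setoid using (respʳ-flip)
open import Relation.Binary.PropositionalEquality as ≡ using (_≡_; _≗_; refl; cong)
open ≡.≡-Reasoning
open import Relation.Nullary using (¬_; Dec; yes; no; does; contradiction)
open import Relation.Nullary.Decidable as Decidable using (T?; does-⇔; dec-true)

T-does : ∀ {a} {A : Set a} (a? : Dec A) → T (does a?) ⇔ A
T-does (yes a) = mk⇔ (λ _ → a) _
T-does (no ¬a) = mk⇔ (λ ()) ¬a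

T-cong : ∀ {b b′} → b ≡ b′ → T b ⇔ T b′
T-cong {b} refl = ⇔-id (T b)

T-⇔⇒≡ : ∀ {b b′} → T b ⇔ T b′ → b ≡ b′
T-⇔⇒≡ {b} {b′} b⇔b′ = does-⇔ b⇔b′ (T? b) (T? b′)

¬T⇒≡false : ∀ {b} → ¬ T b → b ≡ false
¬T⇒≡false {false} _  = refl
¬T⇒≡false {true}  ¬t = contradiction _ ¬t

dependent-∧ : (b : Bool) → (T b → Bool) → Bool
dependent-∧ false _ = false
dependent-∧ true  k = k _

dependent-∧-T : ∀ {b} k (t : T b) → dependent-∧ b k ≡ k t
dependent-∧-T {true} _ _ = refl

dependent-∧-¬T : ∀ {b} k → ¬ T b → dependent-∧ b k ≡ false
dependent-∧-¬T {false} _ _  = refl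
dependent-∧-¬T {true}  _ ¬t = contradiction _ ¬t

module _ {c ℓ} (S : Setoid c ℓ) where
  open Setoid S using (Carrier; _≈_) renaming (sym to ≈-sym)
  open SetoidMembership S renaming (_∈_ to _∈ₛ_)
  open SetoidUnique S using (Unique)

  Unique-lookup-injective : ∀ {xs} → Unique xs → ∀ {i j} → lookup xs i ≈ lookup xs j → i ≡ j
  Unique-lookup-injective {_ ∷ _}  _          {zero}  {zero}  _  = refl
  Unique-lookup-injective {_ ∷ xs} (x≉xs ∷ _) {zero}  {suc j} x≈ =
    contradiction x≈ (All.lookup x≉xs (∈-lookup j))
  Unique-lookup-injective {_ ∷ xs} (x≉xs ∷ _) {suc i} {zero}  ≈x =
    contradiction (≈-sym ≈x) (All.lookup x≉xs (∈-lookup i))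
  Unique-lookup-injective {_ ∷ _}  (_ ∷ u)    {suc i} {suc j} eq =
    cong suc (Unique-lookup-injective u eq)

  injection⇒≤-length : ∀ {m ys} (f : Fin m → Carrier) → (∀ {i j} → f i ≈ f j → i ≡ j) →
                       (∀ i → f i ∈ₛ ys) → m ≤ length ys
  injection⇒≤-length {m} {ys} f f-injective f∈ys with m ≤? length ys
  ... | yes m≤ = m≤
  ... | no  m≰ =
    let i , j , i<j , same-index = pigeonhole (≰⇒> m≰) (Any.index ∘ f∈ys)
    in contradiction (f-injective (index-injective S (f∈ys i) (f∈ys j) same-index)) (<⇒≢ i<j)

Family : ℕ → Set
Family n = Subset n → Bool

∅ᶠ : ∀ {n} → Family n
∅ᶠ _ = false

∈-allSubsets : ∀ {n} (c : Subset n) → c ∈ allSubsets n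
∈-allSubsets []            = here refl
∈-allSubsets (outside ∷ c) = ∈-++⁺ˡ (∈-map⁺ (outside ∷_) (∈-allSubsets c))
∈-allSubsets {suc n} (inside ∷ c) =
  ∈-++⁺ʳ (map (outside ∷_) (allSubsets n)) (∈-map⁺ (inside ∷_) (∈-allSubsets c))

eqFun⇔≗ : ∀ {n} (f g : Family n) → T (eqFun f g) ⇔ f ≗ g
eqFun⇔≗ {n} f g = mk⇔
  (λ eq c → Equivalence.to (T-does (f c ≟ g c))
              (All.lookup (all⁺ _ (allSubsets n) eq) (∈-allSubsets c)))
  (λ f≗g → all⁻ _ {allSubsets n}
              (All.tabulate λ {c} _ → Equivalence.from (T-does (f c ≟ g c)) (f≗g c)))

-- The equality is T ∘ eqFun itself rather than _≗_, so that deduplicating with this setoid's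
-- _≟_ is literally the deduplication in numTrunks.
family-decSetoid : ℕ → DecSetoid 0ℓ 0ℓ
family-decSetoid n = record
  { Carrier          = Family n
  ; _≈_              = λ f g → T (eqFun f g)
  ; isDecEquivalence = record
    { isEquivalence = record
      { refl  = λ {f} → ≗⇒≈ f f (λ _ → refl)
      ; sym   = λ {f} {g} f≈g → ≗⇒≈ g f (≡.sym ∘ ≈⇒≗ f g f≈g)
      ; trans = λ {f} {g} {h} f≈g g≈h →
                  ≗⇒≈ f h (λ c → ≡.trans (≈⇒≗ f g f≈g c) (≈⇒≗ g h g≈h c))
      }
    ; _≟_ = λ f g → T? (eqFun f g)
    }
  }
  where
  ≈⇒≗ : (f g : Family n) → T (eqFun f g) → f ≗ g
  ≈⇒≗ f g = Equivalence.to (eqFun⇔≗ f g)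
  ≗⇒≈ : (f g : Family n) → f ≗ g → T (eqFun f g)
  ≗⇒≈ f g = Equivalence.from (eqFun⇔≗ f g)

_∈≗_ : ∀ {n} → Family n → List (Family n) → Set
_∈≗_ {n} = SetoidMembership._∈_ (DecSetoid.setoid (family-decSetoid n))

_≗?_ : ∀ {n} (f g : Family n) → Dec (f ≗ g)
f ≗? g = Decidable.map (eqFun⇔≗ f g) (T? (eqFun f g))

∪⊆⇔⊆×⊆ : ∀ {n} {σ τ c : Subset n} → σ ∪ τ ⊆ c ⇔ (σ ⊆ c × τ ⊆ c)
∪⊆⇔⊆×⊆ {σ = σ} {τ} {c} = mk⇔ split join
  where
  split : σ ∪ τ ⊆ c → σ ⊆ c × τ ⊆ c
  split σ∪τ⊆c = σ∪τ⊆c ∘ p⊆p∪q τ , σ∪τ⊆c ∘ q⊆p∪q σ τ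
  join : σ ⊆ c × τ ⊆ c → σ ∪ τ ⊆ c
  join (σ⊆c , τ⊆c) = [ σ⊆c , τ⊆c ] ∘ x∈p∪q⁻ σ τ

IsTrunkFamily : (C : Code) → Family (dim C) → Set
IsTrunkFamily C a = a ≗ ∅ᶠ ⊎ ∃ λ σ → a ≗ tkFun C σ

trunkList : (C : Code) → List (Family (dim C))
trunkList C = ∅ᶠ ∷ map (tkFun C) (allSubsets (dim C))

agree-on-code : ∀ (C : Code) {a b : Family (dim C)} →
                (∀ (x : Elem C) → a (proj₁ x) ≡ b (proj₁ x)) →
                (∀ {c} → ¬ T (mem C c) → a c ≡ b c) → a ≗ b
agree-on-code C on off c with T? (mem C c)
... | yes c∈C = on (c , c∈C)
... | no  c∉C = off c∉C

IsTrunk-resp : ∀ {C} {P Q : Elem C → Set} → (∀ x → P x ⇔ Q x) → IsTrunk C P → IsTrunk C Q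
IsTrunk-resp P⇔Q (inj₁ P-empty)    = inj₁ (λ x → P-empty x ∘ Equivalence.from (P⇔Q x))
IsTrunk-resp P⇔Q (inj₂ (σ , P⇔σ⊆)) = inj₂ (σ , λ x → P⇔σ⊆ x ⇔-∘ ⇔-sym (P⇔Q x))

module _ (C : Code) where

  tkFun-∈ : ∀ σ {c} → T (mem C c) → tkFun C σ c ≡ does (σ ⊆? c)
  tkFun-∈ σ c∈C = cong (_∧ _) (Equivalence.to T-≡ c∈C)

  tkFun-∉ : ∀ σ {c} → ¬ T (mem C c) → tkFun C σ c ≡ false
  tkFun-∉ σ c∉C = cong (_∧ _) (¬T⇒≡false c∉C)

  T-tkFun : ∀ σ {c} → T (tkFun C σ c) ⇔ (T (mem C c) × σ ⊆ c)
  T-tkFun σ {c} = (⇔-id _ ×-⇔ T-does (σ ⊆? c)) ⇔-∘ T-∧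

  IsTrunkFamily-vanishes : ∀ {a} → IsTrunkFamily C a → ∀ {c} → ¬ T (mem C c) → a c ≡ false
  IsTrunkFamily-vanishes (inj₁ a≗∅)      _   = a≗∅ _
  IsTrunkFamily-vanishes (inj₂ (σ , a≗)) c∉C = ≡.trans (a≗ _) (tkFun-∉ σ c∉C)

  ∈-trunkList⇒IsTrunkFamily : ∀ {a} → a ∈ trunkList C → IsTrunkFamily C a
  ∈-trunkList⇒IsTrunkFamily (here refl) = inj₁ (λ _ → refl)
  ∈-trunkList⇒IsTrunkFamily (there a∈)
    with σ , _ , refl ← ∈-map⁻ (tkFun C) a∈ = inj₂ (σ , λ _ → refl)

  IsTrunkFamily⇒∈≗-trunkList : ∀ {a} → IsTrunkFamily C a → a ∈≗ trunkList C
  IsTrunkFamily⇒∈≗-trunkList (inj₁ a≗∅)      = here (Equivalence.from (eqFun⇔≗ _ _) a≗∅)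
  IsTrunkFamily⇒∈≗-trunkList (inj₂ (σ , a≗)) =
    there (map⁺ (Any.map (λ { refl → Equivalence.from (eqFun⇔≗ _ _) a≗ }) (∈-allSubsets σ)))

  IsTrunkFamily⇒IsTrunk : ∀ {a} → IsTrunkFamily C a → IsTrunk C (λ x → T (a (proj₁ x)))
  IsTrunkFamily⇒IsTrunk (inj₁ a≗∅)      = inj₁ (λ x → Equivalence.to (T-cong (a≗∅ (proj₁ x))))
  IsTrunkFamily⇒IsTrunk (inj₂ (σ , a≗)) = inj₂ (σ , λ (c , c∈C) →
    T-does (σ ⊆? c) ⇔-∘ T-cong (≡.trans (a≗ c) (tkFun-∈ σ c∈C)))

  IsTrunk⇒IsTrunkFamily : ∀ {a} → (∀ {c} → ¬ T (mem C c) → a c ≡ false) →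
                          IsTrunk C (λ x → T (a (proj₁ x))) → IsTrunkFamily C a
  IsTrunk⇒IsTrunkFamily a-vanishes (inj₁ a-empty) =
    inj₁ (agree-on-code C (λ x → ¬T⇒≡false (a-empty x)) a-vanishes)
  IsTrunk⇒IsTrunkFamily {a} a-vanishes (inj₂ (σ , a⇔σ⊆)) = inj₂ (σ , agree-on-code C
    (λ x@(c , c∈C) → ≡.trans (does-⇔ (a⇔σ⊆ x) (T? (a c)) (σ ⊆? c)) (≡.sym (tkFun-∈ σ c∈C)))
    (λ c∉C → ≡.trans (a-vanishes c∉C) (≡.sym (tkFun-∉ σ c∉C))))

module TrunkCounting {C D : Code} (φ : Family (dim D) → Family (dim C))
  (φ-trunk    : ∀ {a} → IsTrunkFamily D a → IsTrunkFamily C (φ a))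
  (φ-reflects : ∀ {a a′} → IsTrunkFamily D a → IsTrunkFamily D a′ → φ a ≗ φ a′ → a ≗ a′)
  where

  private
    module FD = DecSetoid (family-decSetoid (dim D))
    module FC = DecSetoid (family-decSetoid (dim C))

    trunksD : List (Family (dim D))
    trunksD = deduplicate FD._≟_ (trunkList D)

    trunksC : List (Family (dim C))
    trunksC = deduplicate FC._≟_ (trunkList C)

    trunksD⊆trunkList : ∀ i → lookup trunksD i ∈ trunkList D
    trunksD⊆trunkList i = ∈-deduplicate⁻ FD._≟_ (trunkList D) (∈-lookup i)

    trunksD-trunk : ∀ i → IsTrunkFamily D (lookup trunksD i)
    trunksD-trunk i = ∈-trunkList⇒IsTrunkFamily D (trunksD⊆trunkList i)

    IsTrunkFamily⇒∈≗-trunksC : ∀ {b} → IsTrunkFamily C b → b ∈≗ trunksC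
    IsTrunkFamily⇒∈≗-trunksC {b} b-trunk =
      ∈-deduplicate⁺ FC.setoid FC._≟_ (λ {x} {y} {z} → respʳ-flip FC.setoid {x} {y} {z})
        {trunkList C} {b} (IsTrunkFamily⇒∈≗-trunkList C b-trunk)

    φ[_] : Fin (numTrunks D) → Family (dim C)
    φ[ i ] = φ (lookup trunksD i)

    φ-injective : ∀ {i j} → φ[ i ] ≗ φ[ j ] → i ≡ j
    φ-injective {i} {j} φi≗φj =
      Unique-lookup-injective FD.setoid (deduplicate-! (family-decSetoid (dim D)) (trunkList D))
        (Equivalence.from (eqFun⇔≗ _ _) (φ-reflects (trunksD-trunk i) (trunksD-trunk j) φi≗φj))

    φ-∈≗ : ∀ i → φ[ i ] ∈≗ trunksC
    φ-∈≗ i = IsTrunkFamily⇒∈≗-trunksC (φ-trunk (trunksD-trunk i))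

  numTrunks-≤ : numTrunks D ≤ numTrunks C
  numTrunks-≤ =
    injection⇒≤-length FC.setoid φ[_] (φ-injective ∘ Equivalence.to (eqFun⇔≗ _ _)) φ-∈≗

  numTrunks-< : ∀ {b} → IsTrunkFamily C b → (∀ {a} → a ∈ trunkList D → ¬ φ a ≗ b) →
                numTrunks D < numTrunks C
  numTrunks-< {b} b-trunk b∉φ[trunks] =
    injection⇒≤-length FC.setoid φ⁺[_] (φ⁺-injective ∘ Equivalence.to (eqFun⇔≗ _ _)) φ⁺-∈≗
    where
    φ⁺[_] : Fin (suc (numTrunks D)) → Family (dim C)
    φ⁺[ zero ]  = b
    φ⁺[ suc i ] = φ[ i ]

    φ⁺-injective : ∀ {i j} → φ⁺[ i ] ≗ φ⁺[ j ] → i ≡ j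
    φ⁺-injective {zero}  {zero}  _  = refl
    φ⁺-injective {zero}  {suc j} eq = contradiction (≡.sym ∘ eq) (b∉φ[trunks] (trunksD⊆trunkList j))
    φ⁺-injective {suc i} {zero}  eq = contradiction eq (b∉φ[trunks] (trunksD⊆trunkList i))
    φ⁺-injective {suc i} {suc j} eq = cong suc (φ-injective eq)

    φ⁺-∈≗ : ∀ i → φ⁺[ i ] ∈≗ trunksC
    φ⁺-∈≗ zero    = IsTrunkFamily⇒∈≗-trunksC b-trunk
    φ⁺-∈≗ (suc i) = φ-∈≗ i

  numTrunks-≮⇒onto : ¬ numTrunks D < numTrunks C →
                     ∀ {b} → IsTrunkFamily C b → ∃ λ a → IsTrunkFamily D a × φ a ≗ b
  numTrunks-≮⇒onto ≮ {b} b-trunk with Any.any? (λ a → φ a ≗? b) (trunkList D)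
  ... | yes hit = let a , a∈ , φa≗b = find hit in a , ∈-trunkList⇒IsTrunkFamily D a∈ , φa≗b
  ... | no  miss = contradiction (numTrunks-< b-trunk (λ a∈ φa≗b → miss (lose a∈ φa≗b))) ≮

mkMorphism : ∀ {C D} (h : Elem C → Elem D) → (∀ σ → IsTrunk C (λ x → σ ⊆ proj₁ (h x))) →
             Morphism C D
mkMorphism h tk-preimage = record
  { fun      = h
  ; preTrunk = λ where
      Q (inj₁ Q-empty)    → inj₁ (λ x → Q-empty (h x))
      Q (inj₂ (σ , Q⇔σ⊆)) → IsTrunk-resp (λ x → ⇔-sym (Q⇔σ⊆ (h x))) (tk-preimage σ)
  }

_∘ᴹ_ : ∀ {C D E} → Morphism D E → Morphism C D → Morphism C E
g ∘ᴹ f = record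
  { fun      = fun g ∘ fun f
  ; preTrunk = λ Q Q-trunk → preTrunk f (Q ∘ fun g) (preTrunk g Q Q-trunk)
  }

inclusion : ∀ {n} {E F : Family n} → (∀ {c} → T (E c) → T (F c)) → Morphism (code n E) (code n F)
inclusion E⊆F = mkMorphism (λ (c , c∈E) → c , E⊆F c∈E) (λ σ → inj₂ (σ , λ _ → ⇔-id _))

Elem-≡ : ∀ {C} {x y : Elem C} → proj₁ x ≡ proj₁ y → x ≡ y
Elem-≡ {x = c , p} {.c , q} refl = cong (c ,_) (T-irrelevant p q)

mem⇔⇒Iso : ∀ {n} {E F : Family n} → (∀ {c} → T (E c) ⇔ T (F c)) → Iso (code n E) (code n F)
mem⇔⇒Iso E⇔F = record
  { to      = inclusion (Equivalence.to E⇔F)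
  ; from    = inclusion (Equivalence.from E⇔F)
  ; from-to = λ _ → refl
  ; to-from = λ _ → refl
  }

Iso-refl : ∀ {C} → Iso C C
Iso-refl = mem⇔⇒Iso (⇔-id _)

Iso-sym : ∀ {C D} → Iso C D → Iso D C
Iso-sym i = record { to = from i ; from = to i ; from-to = to-from i ; to-from = from-to i }

Iso-trans : ∀ {C D E} → Iso C D → Iso D E → Iso C E
Iso-trans i j = record
  { to      = to j ∘ᴹ to i
  ; from    = from i ∘ᴹ from j
  ; from-to = λ x → ≡.trans (cong (proj₁ ∘ fun (from i)) (Elem-≡ (from-to j (fun (to i) x))))
                            (from-to i x)
  ; to-from = λ z → ≡.trans (cong (proj₁ ∘ fun (to j)) (Elem-≡ (to-from i (fun (from j) z))))
                            (to-from j z)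
  }

FewerTrunksOrIso : Code → Code → Set₁
FewerTrunksOrIso D C = numTrunks D < numTrunks C ⊎ Iso D C

FewerTrunksOrIso-intro : ∀ {C D} → (¬ numTrunks D < numTrunks C → Iso D C) → FewerTrunksOrIso D C
FewerTrunksOrIso-intro {C} {D} ≮⇒Iso with numTrunks D <? numTrunks C
... | yes D<C = inj₁ D<C
... | no  D≮C = inj₂ (≮⇒Iso D≮C)

subcode-fewerTrunksOrIso : ∀ (C : Code) (E : Family (dim C)) → (∀ {c} → T (E c) → T (mem C c)) →
                           (∀ {a} → IsTrunkFamily (code (dim C) E) a → IsTrunkFamily C a) →
                           FewerTrunksOrIso (code (dim C) E) C
subcode-fewerTrunksOrIso C E E⊆C trunk⇒trunk =
  FewerTrunksOrIso-intro λ ≮ → mem⇔⇒Iso (mk⇔ E⊆C (C⊆E ≮))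
  where
  open TrunkCounting {C} {code (dim C) E} id trunk⇒trunk (λ _ _ → id)

  -- C itself is the trunk Tk_C(∅), so it must be a trunk of the subcode
  C⊆E : ¬ numTrunks (code (dim C) E) < numTrunks C → ∀ {c} → T (mem C c) → T (E c)
  C⊆E ≮ {c} c∈C with T? (E c) | numTrunks-≮⇒onto ≮ (inj₂ (⊥ , λ _ → refl))
  ... | yes c∈E | _                  = c∈E
  ... | no  c∉E | a , a-trunk , a≗C = contradiction
    (begin
      true           ≡⟨ ≡.sym (dec-true (⊥ ⊆? c) (⊆-min c)) ⟩
      does (⊥ ⊆? c)  ≡⟨ ≡.sym (tkFun-∈ C ⊥ c∈C) ⟩
      tkFun C ⊥ c    ≡⟨ ≡.sym (a≗C c) ⟩
      a c            ≡⟨ IsTrunkFamily-vanishes (code (dim C) E) a-trunk c∉E ⟩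
      false          ∎)
    (λ ())

module _ (C : Code) (σ : Subset (dim C)) (E : Family (dim C))
         (E⇔Tkσ : ∀ c → T (E c) ⇔ (T (mem C c) × σ ⊆ c)) where

  tkFun-of-trunk : ∀ τ → tkFun (code (dim C) E) τ ≗ tkFun C (σ ∪ τ)
  tkFun-of-trunk τ c =
    T-⇔⇒≡ (⇔-sym (T-tkFun C (σ ∪ τ)) ⇔-∘ (regroup ⇔-∘ T-tkFun (code (dim C) E) τ))
    where
    regroup : (T (E c) × τ ⊆ c) ⇔ (T (mem C c) × σ ∪ τ ⊆ c)
    regroup = mk⇔
      (λ (c∈E , τ⊆c) → let c∈C , σ⊆c = Equivalence.to (E⇔Tkσ c) c∈E
                       in c∈C , Equivalence.from ∪⊆⇔⊆×⊆ (σ⊆c , τ⊆c))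
      (λ (c∈C , σ∪τ⊆c) → let σ⊆c , τ⊆c = Equivalence.to ∪⊆⇔⊆×⊆ σ∪τ⊆c
                         in Equivalence.from (E⇔Tkσ c) (c∈C , σ⊆c) , τ⊆c)

  IsTrunkFamily-of-trunk : ∀ {a} → IsTrunkFamily (code (dim C) E) a → IsTrunkFamily C a
  IsTrunkFamily-of-trunk (inj₁ a≗∅)      = inj₁ a≗∅
  IsTrunkFamily-of-trunk (inj₂ (τ , a≗)) =
    inj₂ (σ ∪ τ , λ c → ≡.trans (a≗ c) (tkFun-of-trunk τ c))

module Image {C D′ : Code} (f : Morphism C D′) (E : Family (dim D′))
             (E≡f[C] : ∀ d → T (E d) ⇔ (∃ λ x → proj₁ (fun f x) ≡ d)) where

  f[C] : Code
  f[C] = code (dim D′) E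

  f̂ : Elem C → Subset (dim D′)
  f̂ x = proj₁ (fun f x)

  corestriction : Morphism C f[C]
  corestriction = mkMorphism (λ x → f̂ x , Equivalence.from (E≡f[C] (f̂ x)) (x , refl))
    (λ σ → preTrunk f (λ y → σ ⊆ proj₁ y) (inj₂ (σ , λ _ → ⇔-id _)))

  pullback : Family (dim D′) → Family (dim C)
  pullback g c = dependent-∧ (mem C c) (λ c∈C → g (f̂ (c , c∈C)))

  pullback-∈ : ∀ g (x : Elem C) → pullback g (proj₁ x) ≡ g (f̂ x)
  pullback-∈ g (c , c∈C) = dependent-∧-T _ c∈C

  pullback-∉ : ∀ {g c} → ¬ T (mem C c) → pullback g c ≡ false
  pullback-∉ {g} = dependent-∧-¬T _

  pullback-trunk : ∀ {a} → IsTrunkFamily f[C] a → IsTrunkFamily C (pullback a)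
  pullback-trunk {a} a-trunk = IsTrunk⇒IsTrunkFamily C (pullback-∉ {a})
    (IsTrunk-resp (λ x → T-cong (≡.sym (pullback-∈ a x)))
      (preTrunk corestriction _ (IsTrunkFamily⇒IsTrunk f[C] a-trunk)))

  pullback-reflects : ∀ {a a′} → IsTrunkFamily f[C] a → IsTrunkFamily f[C] a′ →
                      pullback a ≗ pullback a′ → a ≗ a′
  pullback-reflects {a} {a′} a-trunk a′-trunk a*≗a′* = agree-on-code f[C] on-f[C]
    (λ d∉E → ≡.trans (IsTrunkFamily-vanishes f[C] a-trunk d∉E)
                     (≡.sym (IsTrunkFamily-vanishes f[C] a′-trunk d∉E)))
    where
    on-f[C] : ∀ (y : Elem f[C]) → a (proj₁ y) ≡ a′ (proj₁ y)
    on-f[C] (d , d∈E) with x , refl ← Equivalence.to (E≡f[C] d) d∈E = begin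
      a (f̂ x)               ≡⟨ ≡.sym (pullback-∈ a x) ⟩
      pullback a (proj₁ x)  ≡⟨ a*≗a′* (proj₁ x) ⟩
      pullback a′ (proj₁ x) ≡⟨ pullback-∈ a′ x ⟩
      a′ (f̂ x)              ∎

  open TrunkCounting pullback pullback-trunk pullback-reflects

  numTrunks-image-≤ : numTrunks f[C] ≤ numTrunks C
  numTrunks-image-≤ = numTrunks-≤

  module _ (≮ : ¬ numTrunks f[C] < numTrunks C) where

    tkFun-pullback : ∀ σ → ∃ λ a → IsTrunkFamily f[C] a × pullback a ≗ tkFun C σ
    tkFun-pullback σ = numTrunks-≮⇒onto ≮ (inj₂ (σ , λ _ → refl))

    -- Tk_C(c) is a pullback, so it contains every c′ in the fibre of c
    fibre-⊆ : ∀ {x x′} → f̂ x ≡ f̂ x′ → proj₁ x ⊆ proj₁ x′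
    fibre-⊆ {x@(c , c∈C)} {x′@(c′ , c′∈C)} fx≡fx′ with a , _ , a*≗Tkc ← tkFun-pullback c =
      Equivalence.to (T-does (c ⊆? c′)) (Equivalence.from T-≡ (begin
        does (c ⊆? c′)  ≡⟨ ≡.sym (tkFun-∈ C c c′∈C) ⟩
        tkFun C c c′    ≡⟨ ≡.sym (a*≗Tkc c′) ⟩
        pullback a c′   ≡⟨ pullback-∈ a x′ ⟩
        a (f̂ x′)        ≡⟨ cong a (≡.sym fx≡fx′) ⟩
        a (f̂ x)         ≡⟨ ≡.sym (pullback-∈ a x) ⟩
        pullback a c    ≡⟨ a*≗Tkc c ⟩
        tkFun C c c     ≡⟨ tkFun-∈ C c c∈C ⟩
        does (c ⊆? c)   ≡⟨ dec-true (c ⊆? c) ⊆-refl ⟩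
        true            ∎))

    f̂-injective : ∀ {x x′} → f̂ x ≡ f̂ x′ → proj₁ x ≡ proj₁ x′
    f̂-injective fx≡fx′ = ⊆-antisym (fibre-⊆ fx≡fx′) (fibre-⊆ (≡.sym fx≡fx′))

    section : Elem f[C] → Elem C
    section (d , d∈E) = proj₁ (Equivalence.to (E≡f[C] d) d∈E)

    f̂∘section : ∀ y → f̂ (section y) ≡ proj₁ y
    f̂∘section (d , d∈E) = proj₂ (Equivalence.to (E≡f[C] d) d∈E)

    section-morphism : Morphism f[C] C
    section-morphism = mkMorphism section tk-preimage
      where
      tk-preimage : ∀ σ → IsTrunk f[C] (λ y → σ ⊆ proj₁ (section y))
      tk-preimage σ with a , a-trunk , a*≗Tkσ ← tkFun-pullback σ =
        IsTrunk-resp (λ y → T-does (σ ⊆? proj₁ (section y)) ⇔-∘ T-cong (begin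
            a (proj₁ y)                     ≡⟨ cong a (≡.sym (f̂∘section y)) ⟩
            a (f̂ (section y))               ≡⟨ ≡.sym (pullback-∈ a (section y)) ⟩
            pullback a (proj₁ (section y))  ≡⟨ a*≗Tkσ _ ⟩
            tkFun C σ (proj₁ (section y))   ≡⟨ tkFun-∈ C σ (proj₂ (section y)) ⟩
            does (σ ⊆? proj₁ (section y))   ∎))
          (IsTrunkFamily⇒IsTrunk f[C] a-trunk)

    f[C]≅C : Iso f[C] C
    f[C]≅C = record
      { to      = section-morphism
      ; from    = corestriction
      ; from-to = f̂∘section
      ; to-from = λ x → f̂-injective (f̂∘section (fun corestriction x))
      }

  image-fewerTrunksOrIso : FewerTrunksOrIso f[C] C
  image-fewerTrunksOrIso = FewerTrunksOrIso-intro f[C]≅C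

-- D is the image of C under the inverse isomorphism
Iso⇒numTrunks-≤ : ∀ {C D} → Iso D C → numTrunks D ≤ numTrunks C
Iso⇒numTrunks-≤ {C} {D} D≅C = Image.numTrunks-image-≤ (from D≅C) (mem D) λ d → mk⇔
  (λ d∈D → fun (to D≅C) (d , d∈D) , from-to D≅C (d , d∈D))
  (λ (x , fx≡d) → ≡.subst (T ∘ mem D) fx≡d (proj₂ (fun (from D≅C) x)))

FewerTrunksOrIso-trans : ∀ {C D E} → FewerTrunksOrIso E D → FewerTrunksOrIso D C →
                         FewerTrunksOrIso E C
FewerTrunksOrIso-trans (inj₁ E<D) (inj₁ D<C) = inj₁ (<-trans E<D D<C)
FewerTrunksOrIso-trans (inj₁ E<D) (inj₂ D≅C) = inj₁ (<-≤-trans E<D (Iso⇒numTrunks-≤ D≅C))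
FewerTrunksOrIso-trans (inj₂ E≅D) (inj₁ D<C) = inj₁ (≤-<-trans (Iso⇒numTrunks-≤ E≅D) D<C)
FewerTrunksOrIso-trans (inj₂ E≅D) (inj₂ D≅C) = inj₂ (Iso-trans E≅D D≅C)

step-fewerTrunksOrIso : ∀ {C D} → Step C D → FewerTrunksOrIso D C
step-fewerTrunksOrIso {C} (emptyTrunk E E-empty) =
  subcode-fewerTrunksOrIso C E (λ {c} c∈E → contradiction c∈E (E-empty c)) λ where
    (inj₁ a≗∅)      → inj₁ a≗∅
    (inj₂ (τ , a≗)) → inj₁ (λ c → ≡.trans (a≗ c) (tkFun-∉ (code (dim C) E) τ (E-empty c)))
step-fewerTrunksOrIso {C} (trunk E σ E⇔Tkσ) =
  subcode-fewerTrunksOrIso C E (proj₁ ∘ Equivalence.to (E⇔Tkσ _))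
    (IsTrunkFamily-of-trunk C σ E E⇔Tkσ)
step-fewerTrunksOrIso (image D′ f E E≡f[C]) = Image.image-fewerTrunksOrIso f E E≡f[C]

steps-fewerTrunksOrIso : ∀ {C D} → Steps C D → FewerTrunksOrIso D C
steps-fewerTrunksOrIso done              = inj₂ Iso-refl
steps-fewerTrunksOrIso (steps then step) =
  FewerTrunksOrIso-trans (step-fewerTrunksOrIso step) (steps-fewerTrunksOrIso steps)

corollary3p17 : (C D : Code) → D ≺ C → numTrunks D < numTrunks C
corollary3p17 C D ((E , C⇝E , E≅D) , D≇C)
  with FewerTrunksOrIso-trans (inj₂ (Iso-sym E≅D)) (steps-fewerTrunksOrIso C⇝E)
... | inj₁ D<C = D<C
... | inj₂ D≅C = contradiction D≅C D≇C
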